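{- Let $\Sigma=\{\mathsf{a},\mathsf{b}\}$ and $k\in\mathbb{N}_0$. Then the language $\mathcal{S}(\{\mathsf{a}\},\{\mathsf{b}\},\lfloor k/2\rfloor)^*$ contains every balanced string in $\Sigma^*$ of length at most $k$.
   Context: $\Sigma^*$ is the set of finite strings over $\Sigma$, $\mathsf{e}$ the empty string; $+$ is union of languages, juxtaposition is concatenation, $\mathcal{L}^2=\mathcal{L}\mathcal{L}$, $\mathcal{L}^*=\bigcup_{j\ge0}\mathcal{L}^j$ with $\mathcal{L}^0=\{\mathsf{e}\}$. A string $s$ is balanced if the number of occurrences of $\mathsf{a}$ equals that of $\mathsf{b}$. For languages $\mathcal{L}_1,\mathcal{L}_2$: $\mathcal{S}(\mathcal{L}_1,\mathcal{L}_2,0)=\{\mathsf{e}\}$ and $\mathcal{S}(\mathcal{L}_1,\mathcal{L}_2,k)=\mathcal{L}_1\mathcal{S}(\mathcal{L}_1,\mathcal{L}_2,k-1)^2\mathcal{L}_2+\mathcal{L}_2\mathcal{S}(\mathcal{L}_1,\mathcal{L}_2,k-1)^2\mathcal{L}_1+\{\mathsf{e}\}$ for $k\ge1$. -}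

module Defs where

open import Level using (0ℓ)
open import Data.Nat using (ℕ; zero; suc; _≤_; _/_)
open import Data.List using (List; []; _∷_; _++_; length; filter)
open import Data.Product using (∃₂; _×_; _,_)
open import Data.Sum using (_⊎_)
open import Relation.Binary.PropositionalEquality using (_≡_)
open import Relation.Nullary using (Dec; yes; no)

data Σ : Set where
  a b : Σ

Lang : Set₁
Lang = List Σ → Set

⟦_⟧ : List Σ → Lang
⟦ w ⟧ s = s ≡ w

ε-lang : Lang
ε-lang = ⟦ [] ⟧

_∪_ : Lang → Lang → Lang
(L₁ ∪ L₂) s = L₁ s ⊎ L₂ s
infixr 5 _∪_

_·_ : Lang → Lang → Lang
(L₁ · L₂) s = ∃₂ λ u v → (s ≡ u ++ v) × (L₁ u × L₂ v)
infixr 6 _·_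

_^_ : Lang → ℕ → Lang
L ^ zero = ε-lang
L ^ suc j = L · (L ^ j)

_⋆ : Lang → Lang
(L ⋆) s = Data.Product.∃ λ j → (L ^ j) s

S : Lang → Lang → ℕ → Lang
S L₁ L₂ zero = ε-lang
S L₁ L₂ (suc k) =
  (L₁ · (S L₁ L₂ k ^ 2) · L₂) ∪ (L₂ · (S L₁ L₂ k ^ 2) · L₁) ∪ ε-lang

count : Σ → List Σ → ℕ
count x [] = 0
count a (a ∷ s) = suc (count a s)
count a (b ∷ s) = count a s
count b (a ∷ s) = count b s
count b (b ∷ s) = suc (count b s)

Balanced : List Σ → Set
Balanced s = count a s ≡ count b s

-- A balanced word x m y with y ≠ x is x m x̄ with m balanced. If y = x, the other letter
-- leads by two in m; cutting m at the last point where the counts agree writes the word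
-- as (x p x̄)(x̄ q x) with p and q balanced. Every piece has fewer a's than the whole, so
-- by induction on n each balanced word with at most n a's lies in S(n)², and a balanced
-- word of length at most k has at most ⌊k/2⌋ a's.
module Submission where

open import Defs
open import Data.Nat using (ℕ; zero; suc; _+_; _*_; _≤_; _/_; s≤s)
open import Data.Nat.Properties
  using (suc-injective; +-comm; +-suc; +-identityʳ; *-comm; ≤-trans; n≤1+n; m+n≤o⇒m≤o; m+n≤o⇒n≤o; module ≤-Reasoning)
open import Data.Nat.DivMod using (m*n/n≡m; /-congˡ; /-monoˡ-≤)
open import Data.List using (List; []; _∷_; _++_; _∷ʳ_; length; initLast; _∷ʳ′_)
open import Data.List.Properties using (++-identityʳ; ++-assoc)
open import Data.Product using (∃₂; _×_; _,_)
open import Data.Sum using (inj₁; inj₂)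
open import Relation.Binary.PropositionalEquality
  using (_≡_; refl; sym; trans; cong; cong₂; subst; module ≡-Reasoning)

other : Σ → Σ
other a = b
other b = a

count-++ : ∀ x u v → count x (u ++ v) ≡ count x u + count x v
count-++ a []      v = refl
count-++ a (a ∷ u) v = cong suc (count-++ a u v)
count-++ a (b ∷ u) v = count-++ a u v
count-++ b []      v = refl
count-++ b (a ∷ u) v = count-++ b u v
count-++ b (b ∷ u) v = cong suc (count-++ b u v)

count-∷ʳ : ∀ x y m → count x (m ∷ʳ y) ≡ count x (y ∷ []) + count x m
count-∷ʳ x y m = trans (count-++ x m (y ∷ [])) (+-comm (count x m) (count x (y ∷ [])))

length≡count-a+count-b : ∀ s → length s ≡ count a s + count b s
length≡count-a+count-b []      = refl
length≡count-a+count-b (a ∷ s) = cong suc (length≡count-a+count-b s)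
length≡count-a+count-b (b ∷ s) =
  trans (cong suc (length≡count-a+count-b s)) (sym (+-suc (count a s) (count b s)))

wrap : Σ → List Σ → List Σ
wrap x m = x ∷ m ∷ʳ other x

count-wrap : ∀ y x m → count y (wrap x m) ≡ suc (count y m)
count-wrap a a m = cong suc (count-∷ʳ a b m)
count-wrap a b m = count-∷ʳ a a m
count-wrap b a m = count-∷ʳ b b m
count-wrap b b m = cong suc (count-∷ʳ b a m)

count-wrap-++-wrap : ∀ y x z p q → count y (wrap x p ++ wrap z q) ≡ suc (count y p) + suc (count y q)
count-wrap-++-wrap y x z p q =
  trans (count-++ y (wrap x p) (wrap z q)) (cong₂ _+_ (count-wrap y x p) (count-wrap y z q))

balanced-unwrap : ∀ x m → Balanced (wrap x m) → Balanced m
balanced-unwrap x m bal = suc-injective (trans (sym (count-wrap a x m)) (trans bal (count-wrap b x m)))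

wrap-++-wrap : ∀ x y p q → wrap x p ++ wrap y q ≡ x ∷ (p ++ other x ∷ y ∷ q) ∷ʳ other y
wrap-++-wrap x y p q = cong (x ∷_) (begin
  (p ∷ʳ other x) ++ y ∷ q ∷ʳ other y  ≡⟨ ++-assoc p (other x ∷ []) (y ∷ q ∷ʳ other y) ⟩
  p ++ other x ∷ y ∷ q ∷ʳ other y     ≡⟨ ++-assoc p (other x ∷ y ∷ q) (other y ∷ []) ⟨
  (p ++ other x ∷ y ∷ q) ∷ʳ other y   ∎)
  where open ≡-Reasoning

-- Cut t at the last prefix where y leads by exactly c; from there the lead can only climb.
split-at-double : ∀ y t c → count y t ≡ suc (suc (c + count (other y) t)) →
  ∃₂ λ p q → t ≡ p ++ y ∷ y ∷ q × count y p ≡ c + count (other y) p × count y q ≡ count (other y) q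
split-at-double a (b ∷ t) c h with split-at-double a t (suc c) (trans h (cong (λ n → suc (suc n)) (+-suc c _)))
... | p , q , refl , hp , hq = b ∷ p , q , refl , trans hp (sym (+-suc c _)) , hq
split-at-double a (a ∷ t) (suc c) h with split-at-double a t c (suc-injective h)
... | p , q , refl , hp , hq = a ∷ p , q , refl , cong suc hp , hq
split-at-double a (a ∷ a ∷ t) zero h = [] , t , refl , refl , suc-injective (suc-injective h)
split-at-double a (a ∷ b ∷ t) zero h with split-at-double a t zero (suc-injective h)
... | p , q , refl , hp , hq = a ∷ b ∷ p , q , refl , cong suc hp , hq
split-at-double b (a ∷ t) c h with split-at-double b t (suc c) (trans h (cong (λ n → suc (suc n)) (+-suc c _)))
... | p , q , refl , hp , hq = a ∷ p , q , refl , trans hp (sym (+-suc c _)) , hq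
split-at-double b (b ∷ t) (suc c) h with split-at-double b t c (suc-injective h)
... | p , q , refl , hp , hq = b ∷ p , q , refl , cong suc hp , hq
split-at-double b (b ∷ b ∷ t) zero h = [] , t , refl , refl , suc-injective (suc-injective h)
split-at-double b (b ∷ a ∷ t) zero h with split-at-double b t zero (suc-injective h)
... | p , q , refl , hp , hq = b ∷ a ∷ p , q , refl , cong suc hp , hq

data BalancedView : List Σ → Set where
  empty : BalancedView []
  one   : ∀ x m → Balanced m → BalancedView (wrap x m)
  two   : ∀ x p q → Balanced p → Balanced q → BalancedView (wrap x p ++ wrap (other x) q)

balanced-view : ∀ s → Balanced s → BalancedView s
balanced-view []      bal = empty
balanced-view (x ∷ t) bal with initLast t
balanced-view (a ∷ _) ()  | []
balanced-view (b ∷ _) ()  | []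
balanced-view (a ∷ _) bal | m ∷ʳ′ b = one a m (balanced-unwrap a m bal)
balanced-view (b ∷ _) bal | m ∷ʳ′ a = one b m (balanced-unwrap b m bal)
balanced-view (a ∷ _) bal | m ∷ʳ′ a
  with split-at-double b m 0 (trans (sym (count-∷ʳ b a m)) (trans (sym bal) (cong suc (count-∷ʳ a a m))))
... | p , q , refl , hp , hq = subst BalancedView (wrap-++-wrap a b p q) (two a p q (sym hp) (sym hq))
balanced-view (b ∷ _) bal | m ∷ʳ′ b
  with split-at-double a m 0 (trans (sym (count-∷ʳ a b m)) (trans bal (cong suc (count-∷ʳ b b m))))
... | p , q , refl , hp , hq = subst BalancedView (wrap-++-wrap b a p q) (two b p q hp hq)

·-++ : ∀ {L M : Lang} {u v} → L u → M v → (L · M) (u ++ v)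
·-++ {u = u} {v} lu mv = u , v , refl , lu , mv

^2-++ : ∀ {L : Lang} {u v} → L u → L v → (L ^ 2) (u ++ v)
^2-++ {v = v} lu lv = ·-++ lu (subst (_ · ε-lang) (++-identityʳ v) (·-++ lv refl))

S-ε : ∀ {L₁ L₂} n → S L₁ L₂ n []
S-ε zero    = refl
S-ε (suc n) = inj₂ (inj₂ refl)

Sab : ℕ → Lang
Sab = S ⟦ a ∷ [] ⟧ ⟦ b ∷ [] ⟧

S⊆S² : ∀ n {u} → Sab n u → (Sab n ^ 2) u
S⊆S² n {u} su = subst (Sab n ^ 2) (++-identityʳ u) (^2-++ su (S-ε n))

wrap∈S : ∀ n x {m} → (Sab n ^ 2) m → Sab (suc n) (wrap x m)
wrap∈S n a h = inj₁ (·-++ refl (·-++ h refl))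
wrap∈S n b h = inj₂ (inj₁ (·-++ refl (·-++ h refl)))

balanced⇒S² : ∀ n s → Balanced s → count a s ≤ n → (Sab n ^ 2) s
balanced⇒S² n s bal ≤n with balanced-view s bal
... | empty = ^2-++ (S-ε n) (S-ε n)
... | one x m bal-m with subst (_≤ n) (count-wrap a x m) ≤n
...   | s≤s {n = n′} ≤n′ = S⊆S² (suc n′) (wrap∈S n′ x (balanced⇒S² n′ m bal-m ≤n′))
balanced⇒S² n s bal ≤n | two x p q bal-p bal-q
  with subst (_≤ n) (count-wrap-++-wrap a x (other x) p q) ≤n
...   | s≤s {n = n′} ≤n′ =
  ^2-++ (wrap∈S n′ x (balanced⇒S² n′ p bal-p (m+n≤o⇒m≤o _ ≤n′)))
        (wrap∈S n′ (other x) (balanced⇒S² n′ q bal-q (≤-trans (n≤1+n _) (m+n≤o⇒n≤o _ ≤n′))))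

count-a≤half-length : ∀ s {k} → Balanced s → length s ≤ k → count a s ≤ k / 2
count-a≤half-length s {k} bal len≤k = begin
  count a s              ≡⟨ m*n/n≡m (count a s) 2 ⟨
  count a s * 2 / 2      ≡⟨ /-congˡ {o = 2} length≡2*count-a ⟨
  length s / 2           ≤⟨ /-monoˡ-≤ 2 len≤k ⟩
  k / 2                  ∎
  where
  open ≤-Reasoning
  length≡2*count-a : length s ≡ count a s * 2
  length≡2*count-a = trans (length≡count-a+count-b s)
    (trans (cong (count a s +_) (trans (sym bal) (sym (+-identityʳ (count a s))))) (*-comm 2 (count a s)))

corollary1 : (k : ℕ) (s : List Σ) → Balanced s → length s ≤ k →
    (S ⟦ a ∷ [] ⟧ ⟦ b ∷ [] ⟧ (k / 2) ⋆) s
corollary1 k s bal len≤k = 2 , balanced⇒S² (k / 2) s bal (count-a≤half-length s bal len≤k)
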